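{- Let $K_n=(V,E)$ be the complete graph with $|V|=n\ge 4$. Then the graph of the cone partition for the min-cut problem with non-negative edges, whose vertices are the cones $K^{+}_{\min}(X)$ for all cuts $X$ and whose edges join adjacent cones, has diameter exactly $2$.
   Context: Let $d=\binom{n}{2}=|E|$. For $S\subseteq V$, the cut vector $\mathbf{v}(S)\in\{0,1\}^{d}$ has coordinates indexed by edges $\{i,j\}\in E$, with $\mathbf{v}(S)_{i,j}=1$ if $|S\cap\{i,j\}|=1$ and $0$ otherwise. A cut is a nonempty proper subset $X\subset V$, where $X$ and its complement $V\setminus X$ are identified; the empty cut is excluded, so there are $2^{n-1}-1$ cuts. For a cut $X$, $K^{+}_{\min}(X)=\{\mathbf{c}\in\mathbb{R}^{d}:\ \mathbf{c}\ge\mathbf{0},\ \langle\mathbf{c},\mathbf{v}(X)\rangle\le\langle\mathbf{c},\mathbf{v}(Y)\rangle \text{ for all cuts } Y\}$. Two cones $K^{+}_{\min}(X),K^{+}_{\min}(Y)$ with $X\ne Y$ are adjacent if $\dim\big(K^{+}_{\min}(X)\cap K^{+}_{\min}(Y)\big)=d-1$. The graph of the cone partition has one vertex per cut (the cone $K^{+}_{\min}(X)$) and an edge between two cones iff they are adjacent.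
   Formalization: The cones $K^{+}_{\min}(X)$ and the dimensions of their intersections are taken over ℚ^d instead of $\mathbb{R}^{d}$, with linear independence over the rationals. -}

module Defs where

open import Data.Nat using (ℕ; zero; suc; _∸_)
open import Data.Nat.Combinatorics using (_C_)
open import Data.Fin using (Fin; zero; suc; _<_; _<?_)
open import Data.Fin.Subset using (Subset; ∁)
open import Data.Vec using (lookup)
open import Data.Bool using (Bool; true; false; _xor_; if_then_else_)
open import Data.Rational using (ℚ; 0ℚ; 1ℚ; _+_; _*_; _≤_)
open import Data.Product using (Σ; ∃; _×_; _,_)
open import Data.Sum using (_⊎_)
open import Relation.Nullary using (¬_; yes; no)
open import Relation.Binary.PropositionalEquality using (_≡_)

-- Edges of the complete graph K_n: pairs {i,j} represented as (i , j) with i < j.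
Edge : ℕ → Set
Edge n = Σ (Fin n) λ i → Σ (Fin n) λ j → i < j

-- Vectors in ℚ^d, coordinates indexed by edges (d = n C 2).
EVec : ℕ → Set
EVec n = Edge n → ℚ

sumFin : (k : ℕ) → (Fin k → ℚ) → ℚ
sumFin zero f = 0ℚ
sumFin (suc k) f = f zero + sumFin k (λ i → f (suc i))

sumEdges : (n : ℕ) → (Edge n → ℚ) → ℚ
sumEdges n f = sumFin n λ i → sumFin n λ j → h i j
  where
  h : Fin n → Fin n → ℚ
  h i j with i <? j
  ... | yes p = f (i , j , p)
  ... | no _  = 0ℚ

inner : {n : ℕ} → EVec n → EVec n → ℚ
inner {n} c v = sumEdges n λ e → c e * v e

cutVec : {n : ℕ} → Subset n → EVec n
cutVec S (i , j , _) = if lookup S i xor lookup S j then 1ℚ else 0ℚ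

-- a cut: nonempty proper subset (identified with its complement via SameCut)
IsCut : {n : ℕ} → Subset n → Set
IsCut {n} X = (∃ λ i → lookup X i ≡ true) × (∃ λ i → lookup X i ≡ false)

SameCut : {n : ℕ} → Subset n → Subset n → Set
SameCut X Y = X ≡ Y ⊎ X ≡ ∁ Y

InKmin : {n : ℕ} → Subset n → EVec n → Set
InKmin {n} X c =
  (∀ e → 0ℚ ≤ c e) ×
  (∀ (Y : Subset n) → IsCut Y → inner c (cutVec X) ≤ inner c (cutVec Y))

LinIndep : {n k : ℕ} → (Fin k → EVec n) → Set
LinIndep {n} {k} u =
  ∀ (a : Fin k → ℚ) → (∀ e → sumFin k (λ i → a i * u i e) ≡ 0ℚ) → ∀ i → a i ≡ 0ℚ

HasDim : {n : ℕ} → (EVec n → Set) → ℕ → Set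
HasDim {n} C k =
  (∃ λ (u : Fin k → EVec n) → (∀ i → C (u i)) × LinIndep u) ×
  ¬ (∃ λ (u : Fin (suc k) → EVec n) → (∀ i → C (u i)) × LinIndep u)

Adjacent : {n : ℕ} → Subset n → Subset n → Set
Adjacent {n} X Y =
  ¬ SameCut X Y × HasDim (λ c → InKmin X c × InKmin Y c) ((n C 2) ∸ 1)

-- walks of length k in the graph of the cone partition (vertices = cuts up to complement)
Walk : {n : ℕ} → ℕ → Subset n → Subset n → Set
Walk zero X Y = SameCut X Y
Walk {n} (suc k) X Y = ∃ λ (Z : Subset n) → IsCut Z × Adjacent X Z × Walk k Z Y

DistLe : {n : ℕ} → ℕ → Subset n → Subset n → Set
DistLe k X Y = ∃ λ m → m Data.Nat.≤ k × Walk m X Y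

HasDiameter : ℕ → ℕ → Set
HasDiameter n k =
  (∀ (X Y : Subset n) → IsCut X → IsCut Y → DistLe k X Y) ×
  (∃ λ (X : Subset n) → ∃ λ (Y : Subset n) → IsCut X × IsCut Y × ¬ DistLe (k ∸ 1) X Y)

{-# OPTIONS --safe #-}

-- For n ≥ 3 one of the vertices 0, 1, 2 gives a singleton cut {v} different
-- from both X and Y, and every cut X is adjacent to every singleton cut {v} ≠ X.  For the
-- latter let v ∈ X (otherwise pass to the complement), pick x₀ ∈ X ∖ {v} and b₀ ∉ X, and split
-- the vertices into the blocks {v}, X ∖ {v}, V ∖ X.  For each edge e other than p* = {v, x₀}
-- the vector unit e, corrected by unit p* and unit r* (r* = {x₀, b₀}) so that X and {v} get
-- equal weight, plus weight 2 on the edges inside a block, lies in both cones; these d − 1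
-- vectors are triangular, hence independent.  Conversely every c in both cones satisfies
-- ⟨c, v(X)⟩ = ⟨c, v({v})⟩, a linear condition involving the coordinate p*.
--
-- For X = {0,1} and Y = {0,2} submodularity of the cut function,
-- v(X) + v(Y) = v(X ∩ Y) + v(X ∪ Y) + 2·unit {1,2}, forces c{1,2} = 0 on both cones once
-- n ≥ 4 makes X ∪ Y a cut; with ⟨c, v(X)⟩ = ⟨c, v(Y)⟩, which involves c{0,2}, the two cones
-- meet in dimension at most d − 2.

module Submission where

open import Defs
open import Data.Nat as ℕ using (ℕ; zero; suc; _≤_; z≤n; s≤s)
import Data.Nat.Properties as ℕP
open import Data.Nat.Combinatorics using (_C_; nC1≡n; nCk+nC[k+1]≡[n+1]C[k+1])
open import Data.Fin as Fin using (Fin; zero; suc; punchIn; punchOut; _<?_)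
open import Data.Fin.Patterns using (0F; 1F; 2F; 3F)
import Data.Fin.Properties as FinP
open import Data.Fin.Subset using (Subset; ∁; ⁅_⁆; _∩_; _∪_)
open import Data.Fin.Subset.Properties using (x∈⁅x⁆; x≢y⇒x∉⁅y⁆)
open import Data.Vec as Vec using (Vec; lookup; _∷_)
import Data.Vec.Properties as VecP
open import Data.Vec.Functional using (insertAt)
open import Data.Vec.Functional.Properties using (insertAt-lookup; insertAt-punchIn)
open import Data.Bool as Bool using (Bool; true; false; _xor_; _∧_; _∨_; not; if_then_else_)
import Data.Bool.Properties as BoolP
open import Data.Rational as ℚ using (ℚ; 0ℚ; 1ℚ; _+_; _*_; -_)
import Data.Rational.Properties as ℚP
open import Data.Rational.Solver using (module +-*-Solver)
open import Algebra.Bundles using (CommutativeRing)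
open import Algebra.Properties.Semiring.Sum (CommutativeRing.semiring ℚP.+-*-commutativeRing)
  using (sum; sum-cong-≗; sum-replicate-zero; ∑-distrib-+; *-distribˡ-sum; *-distribʳ-sum; sum-remove)
open import Data.Product using (Σ; ∃; _×_; _,_; proj₁; proj₂; swap)
import Data.Product.Properties as ×P
open import Data.Sum using (_⊎_; inj₁; inj₂)
open import Data.Unit using (⊤; tt)
open import Relation.Nullary using (¬_; Dec; yes; no; contradiction; does)
open import Relation.Nullary.Decidable
  using (True; dec-true; dec-false; toWitness; toWitnessFalse; _⊎-dec_; _×-dec_; ¬?; decidable-stable)
open import Relation.Binary.PropositionalEquality
open import Function using (_∘_)
open import Relation.Binary.Definitions using (tri<; tri≈; tri>)

indicator : Bool → ℚ
indicator b = if b then 1ℚ else 0ℚ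

≤-by-eval : ∀ {p q : ℚ} {p≤q : True (p ℚP.≤? q)} → p ℚ.≤ q
≤-by-eval {p≤q = p≤q} = toWitness p≤q

0≤indicator : ∀ b → 0ℚ ℚ.≤ indicator b
0≤indicator true = ≤-by-eval
0≤indicator false = ≤-by-eval

0≤* : ∀ {x y} → 0ℚ ℚ.≤ x → 0ℚ ℚ.≤ y → 0ℚ ℚ.≤ x * y
0≤* {x} {y} 0≤x 0≤y =
  ℚP.nonNegative⁻¹ _ {{ℚP.nonNeg*nonNeg⇒nonNeg x {{ℚ.nonNegative 0≤x}} y {{ℚ.nonNegative 0≤y}}}}

x≤x+y : ∀ x {y} → 0ℚ ℚ.≤ y → x ℚ.≤ x + y
x≤x+y x {y} 0≤y = subst (ℚ._≤ x + y) (ℚP.+-identityʳ x) (ℚP.+-monoʳ-≤ x 0≤y)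

x+y≤x⇒y≤0 : ∀ x y → x + y ℚ.≤ x → y ℚ.≤ 0ℚ
x+y≤x⇒y≤0 x y x+y≤x = subst₂ ℚ._≤_ (solve 2 (λ x y → (x :+ y) :- x := y) refl x y) (ℚP.+-inverseʳ x)
  (ℚP.+-monoˡ-≤ (- x) x+y≤x)
  where open +-*-Solver

x*y≡0⇒x≡0 : ∀ x y → y ≢ 0ℚ → x * y ≡ 0ℚ → x ≡ 0ℚ
x*y≡0⇒x≡0 x y y≢0 xy≡0 = begin
  x                  ≡⟨ ℚP.*-identityʳ x ⟨
  x * 1ℚ             ≡⟨ cong (x *_) (ℚP.*-inverseʳ y) ⟨
  x * (y * ℚ.1/ y)   ≡⟨ ℚP.*-assoc x y (ℚ.1/ y) ⟨
  x * y * ℚ.1/ y     ≡⟨ cong (_* ℚ.1/ y) xy≡0 ⟩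
  0ℚ * ℚ.1/ y        ≡⟨ ℚP.*-zeroˡ (ℚ.1/ y) ⟩
  0ℚ                 ∎
  where
  open ≡-Reasoning
  instance
    _ : ℚ.NonZero y
    _ = ℚ.≢-nonZero y≢0

1≤x⇒x≢0 : ∀ {x} → 1ℚ ℚ.≤ x → x ≢ 0ℚ
1≤x⇒x≢0 1≤x refl = contradiction 1≤x (toWitnessFalse {a? = 1ℚ ℚP.≤? 0ℚ} tt)

sumFin≡sum : ∀ k (f : Fin k → ℚ) → sumFin k f ≡ sum f
sumFin≡sum zero f = refl
sumFin≡sum (suc k) f = cong (f zero +_) (sumFin≡sum k (f ∘ suc))

sum-zero : ∀ {k} {f : Fin k → ℚ} → (∀ i → f i ≡ 0ℚ) → sum f ≡ 0ℚ
sum-zero {k} f≗0 = trans (sum-cong-≗ f≗0) (sum-replicate-zero k)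

sum-single : ∀ {k} (f : Fin k → ℚ) i → (∀ j → j ≢ i → f j ≡ 0ℚ) → sum f ≡ f i
sum-single {suc k} f i vanish = begin
  sum f                        ≡⟨ sum-remove f ⟩
  f i + sum (f ∘ punchIn i)    ≡⟨ cong (f i +_) (sum-zero (λ j → vanish _ (FinP.punchInᵢ≢i i j))) ⟩
  f i + 0ℚ                     ≡⟨ ℚP.+-identityʳ (f i) ⟩
  f i                          ∎
  where open ≡-Reasoning

sum-mono : ∀ {k} {f g : Fin k → ℚ} → (∀ i → f i ℚ.≤ g i) → sum f ℚ.≤ sum g
sum-mono {zero} f≤g = ℚP.≤-refl
sum-mono {suc k} f≤g = ℚP.+-mono-≤ (f≤g zero) (sum-mono (f≤g ∘ suc))

≡-dec-Edge : ∀ {n} (e e′ : Edge n) → Dec (e ≡ e′)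
≡-dec-Edge = ×P.≡-dec FinP._≟_ (×P.≡-dec FinP._≟_ λ p q → yes (FinP.<-irrelevant p q))

edge-≡ : ∀ {n} {i j : Fin n} (p q : i Fin.< j) → _≡_ {A = Edge n} (i , j , p) (i , j , q)
edge-≡ p q = cong (λ r → _ , _ , r) (FinP.<-irrelevant p q)

onPairs : ∀ {n} → (Edge n → ℚ) → Fin n → Fin n → ℚ
onPairs f i j with i <? j
... | yes i<j = f (i , j , i<j)
... | no _ = 0ℚ

-- The summand of `sumEdges` is a with-function local to Defs; unification names it here.
summand : ∀ n (f : Edge n → ℚ) → Σ (Fin n → Fin n → ℚ) λ h → sumEdges n f ≡ sumFin n (λ i → sumFin n (h i))
summand n f = _ , refl

summand≡onPairs : ∀ n (f : Edge n → ℚ) i j → proj₁ (summand n f) i j ≡ onPairs f i j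
summand≡onPairs n f i j with i <? j
... | yes _ = refl
... | no _ = refl

sumEdges≡∑∑ : ∀ n (f : Edge n → ℚ) → sumEdges n f ≡ sum (λ i → sum (onPairs f i))
sumEdges≡∑∑ n f = begin
  sumEdges n f                     ≡⟨ proj₂ (summand n f) ⟩
  sumFin n (λ i → sumFin n (h i))  ≡⟨ sumFin≡sum n (λ i → sumFin n (h i)) ⟩
  sum (λ i → sumFin n (h i))       ≡⟨ sum-cong-≗ (λ i → sumFin≡sum n (h i)) ⟩
  sum (λ i → sum (h i))            ≡⟨ sum-cong-≗ (λ i → sum-cong-≗ (summand≡onPairs n f i)) ⟩
  sum (λ i → sum (onPairs f i))    ∎
  where
  open ≡-Reasoning
  h : Fin n → Fin n → ℚ
  h = proj₁ (summand n f)

module _ {n : ℕ} where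

  onPairs-lift : (R : ℚ → ℚ → Set) → R 0ℚ 0ℚ → {f g : Edge n → ℚ} → (∀ e → R (f e) (g e)) →
                 ∀ i j → R (onPairs f i j) (onPairs g i j)
  onPairs-lift R R00 fRg i j with i <? j
  ... | yes i<j = fRg (i , j , i<j)
  ... | no _ = R00

  sumEdges-lift : (R : ℚ → ℚ → Set) → R 0ℚ 0ℚ →
                  (∀ {k} {f g : Fin k → ℚ} → (∀ i → R (f i) (g i)) → R (sum f) (sum g)) →
                  {f g : Edge n → ℚ} → (∀ e → R (f e) (g e)) → R (sumEdges n f) (sumEdges n g)
  sumEdges-lift R R00 sum-R {f} {g} fRg = subst₂ R (sym (sumEdges≡∑∑ n f)) (sym (sumEdges≡∑∑ n g))
    (sum-R (λ i → sum-R (onPairs-lift R R00 fRg i)))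

  sumEdges-cong : {f g : Edge n → ℚ} → (∀ e → f e ≡ g e) → sumEdges n f ≡ sumEdges n g
  sumEdges-cong = sumEdges-lift _≡_ refl sum-cong-≗

  sumEdges-mono : {f g : Edge n → ℚ} → (∀ e → f e ℚ.≤ g e) → sumEdges n f ℚ.≤ sumEdges n g
  sumEdges-mono = sumEdges-lift ℚ._≤_ ℚP.≤-refl sum-mono

  onPairs-map₂ : (_∙_ : ℚ → ℚ → ℚ) → 0ℚ ∙ 0ℚ ≡ 0ℚ → (f g : Edge n → ℚ) →
                 ∀ i j → onPairs (λ e → f e ∙ g e) i j ≡ onPairs f i j ∙ onPairs g i j
  onPairs-map₂ _∙_ 0∙0 f g i j with i <? j
  ... | yes _ = refl
  ... | no _ = sym 0∙0

  sumEdges-+ : (f g : Edge n → ℚ) → sumEdges n (λ e → f e + g e) ≡ sumEdges n f + sumEdges n g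
  sumEdges-+ f g = begin
    sumEdges n (λ e → f e + g e)                    ≡⟨ sumEdges≡∑∑ n _ ⟩
    sum (λ i → sum (onPairs (λ e → f e + g e) i))   ≡⟨ sum-cong-≗ (λ i → sum-cong-≗ (onPairs-map₂ _+_ refl f g i)) ⟩
    sum (λ i → sum (λ j → F i j + G i j))           ≡⟨ sum-cong-≗ (λ i → ∑-distrib-+ (F i) (G i)) ⟩
    sum (λ i → sum (F i) + sum (G i))               ≡⟨ ∑-distrib-+ (λ i → sum (F i)) (λ i → sum (G i)) ⟩
    sum (λ i → sum (F i)) + sum (λ i → sum (G i))   ≡⟨ cong₂ _+_ (sumEdges≡∑∑ n f) (sumEdges≡∑∑ n g) ⟨
    sumEdges n f + sumEdges n g                     ∎
    where
    open ≡-Reasoning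
    F G : Fin n → Fin n → ℚ
    F = onPairs f
    G = onPairs g

  sumEdges-* : (a : ℚ) (f : Edge n → ℚ) → sumEdges n (λ e → a * f e) ≡ a * sumEdges n f
  sumEdges-* a f = begin
    sumEdges n (λ e → a * f e)                    ≡⟨ sumEdges≡∑∑ n _ ⟩
    sum (λ i → sum (onPairs (λ e → a * f e) i))
      ≡⟨ sum-cong-≗ (λ i → sum-cong-≗ (onPairs-map₂ (λ x _ → a * x) (ℚP.*-zeroʳ a) f f i)) ⟩
    sum (λ i → sum (λ j → a * onPairs f i j))     ≡⟨ sum-cong-≗ (λ i → *-distribˡ-sum a (onPairs f i)) ⟨
    sum (λ i → a * sum (onPairs f i))             ≡⟨ *-distribˡ-sum a (λ i → sum (onPairs f i)) ⟨
    a * sum (λ i → sum (onPairs f i))             ≡⟨ cong (a *_) (sumEdges≡∑∑ n f) ⟨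
    a * sumEdges n f                              ∎
    where open ≡-Reasoning

  sumEdges-zero : {f : Edge n → ℚ} → (∀ e → f e ≡ 0ℚ) → sumEdges n f ≡ 0ℚ
  sumEdges-zero f≗0 =
    trans (sumEdges-cong f≗0) (trans (sumEdges-* 0ℚ (λ _ → 0ℚ)) (ℚP.*-zeroˡ (sumEdges n (λ _ → 0ℚ))))

  sumEdges-single : (f : Edge n → ℚ) (e₀ : Edge n) → (∀ e → e ≢ e₀ → f e ≡ 0ℚ) → sumEdges n f ≡ f e₀
  sumEdges-single f e₀@(i₀ , j₀ , i₀<j₀) vanish = begin
    sumEdges n f                    ≡⟨ sumEdges≡∑∑ n f ⟩
    sum (λ i → sum (onPairs f i))   ≡⟨ sum-single _ i₀ (λ i i≢i₀ → sum-zero (onPairs-row i i≢i₀)) ⟩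
    sum (onPairs f i₀)              ≡⟨ sum-single _ j₀ onPairs-column ⟩
    onPairs f i₀ j₀                 ≡⟨ onPairs-at ⟩
    f e₀                            ∎
    where
    open ≡-Reasoning
    onPairs-row : ∀ i → i ≢ i₀ → ∀ j → onPairs f i j ≡ 0ℚ
    onPairs-row i i≢i₀ j with i <? j
    ... | yes i<j = vanish (i , j , i<j) (i≢i₀ ∘ cong proj₁)
    ... | no _ = refl
    onPairs-column : ∀ j → j ≢ j₀ → onPairs f i₀ j ≡ 0ℚ
    onPairs-column j j≢j₀ with i₀ <? j
    ... | yes i₀<j = vanish (i₀ , j , i₀<j) (j≢j₀ ∘ cong (proj₁ ∘ proj₂))
    ... | no _ = refl
    onPairs-at : onPairs f i₀ j₀ ≡ f e₀
    onPairs-at with i₀ <? j₀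
    ... | yes i₀<j₀′ = cong f (edge-≡ i₀<j₀′ i₀<j₀)
    ... | no i₀≮j₀ = contradiction i₀<j₀ i₀≮j₀

NonNeg : ∀ {n} → EVec n → Set
NonNeg u = ∀ e → 0ℚ ℚ.≤ u e

module _ {n : ℕ} where

  infixl 6 _⊕_
  infixr 7 _⊛_

  _⊕_ : EVec n → EVec n → EVec n
  (u ⊕ w) e = u e + w e

  _⊛_ : ℚ → EVec n → EVec n
  (a ⊛ u) e = a * u e

  unit : Edge n → EVec n
  unit e₀ e = indicator (does (≡-dec-Edge e e₀))

  unit-≢ : ∀ {e₀ e} → e ≢ e₀ → unit e₀ e ≡ 0ℚ
  unit-≢ {e₀} {e} e≢e₀ with ≡-dec-Edge e e₀
  ... | yes e≡e₀ = contradiction e≡e₀ e≢e₀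
  ... | no _ = refl

  unit-≡ : ∀ e → unit e e ≡ 1ℚ
  unit-≡ e with ≡-dec-Edge e e
  ... | yes _ = refl
  ... | no e≢e = contradiction refl e≢e

  unit-nonNeg : ∀ e₀ → NonNeg (unit e₀)
  unit-nonNeg e₀ e = 0≤indicator (does (≡-dec-Edge e e₀))

  comb : ∀ {k} → (Fin k → ℚ) → (Fin k → EVec n) → EVec n
  comb {k} a u e = sumFin k (λ i → a i * u i e)

  inner-congʳ : (c : EVec n) {w w′ : EVec n} → (∀ e → w e ≡ w′ e) → inner c w ≡ inner c w′
  inner-congʳ c w≗w′ = sumEdges-cong (λ e → cong (c e *_) (w≗w′ e))

  inner-⊕ˡ : (u u′ w : EVec n) → inner (u ⊕ u′) w ≡ inner u w + inner u′ w
  inner-⊕ˡ u u′ w = trans (sumEdges-cong (λ e → ℚP.*-distribʳ-+ (w e) (u e) (u′ e)))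
                          (sumEdges-+ (λ e → u e * w e) (λ e → u′ e * w e))

  inner-⊕ʳ : (c u w : EVec n) → inner c (u ⊕ w) ≡ inner c u + inner c w
  inner-⊕ʳ c u w = trans (sumEdges-cong (λ e → ℚP.*-distribˡ-+ (c e) (u e) (w e)))
                         (sumEdges-+ (λ e → c e * u e) (λ e → c e * w e))

  inner-⊛ˡ : (a : ℚ) (u w : EVec n) → inner (a ⊛ u) w ≡ a * inner u w
  inner-⊛ˡ a u w = trans (sumEdges-cong (λ e → ℚP.*-assoc a (u e) (w e))) (sumEdges-* a (λ e → u e * w e))

  inner-zeroˡ : (w : EVec n) → inner (λ _ → 0ℚ) w ≡ 0ℚ
  inner-zeroˡ w = sumEdges-zero (λ e → ℚP.*-zeroˡ (w e))

  inner-supported : (z w : EVec n) (e₀ : Edge n) → (∀ e → e ≢ e₀ → z e ≡ 0ℚ) → inner z w ≡ z e₀ * w e₀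
  inner-supported z w e₀ vanish = sumEdges-single (λ e → z e * w e) e₀
    (λ e e≢e₀ → trans (cong (_* w e) (vanish e e≢e₀)) (ℚP.*-zeroˡ (w e)))

  inner-unitˡ : (e₀ : Edge n) (w : EVec n) → inner (unit e₀) w ≡ w e₀
  inner-unitˡ e₀ w = trans (inner-supported (unit e₀) w e₀ (λ e → unit-≢))
                           (trans (cong (_* w e₀) (unit-≡ e₀)) (ℚP.*-identityˡ (w e₀)))

  inner-comb-cong : ∀ {k} (a : Fin k → ℚ) (u : Fin k → EVec n) {w w′ : EVec n} →
                    (∀ i → inner (u i) w ≡ inner (u i) w′) → inner (comb a u) w ≡ inner (comb a u) w′
  inner-comb-cong {zero} a u {w} {w′} _ = trans (inner-zeroˡ w) (sym (inner-zeroˡ w′))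
  inner-comb-cong {suc k} a u {w} {w′} same = begin
    inner (a zero ⊛ u zero ⊕ rest) w               ≡⟨ inner-⊕ˡ (a zero ⊛ u zero) rest w ⟩
    inner (a zero ⊛ u zero) w + inner rest w       ≡⟨ cong₂ _+_ (inner-⊛ˡ (a zero) (u zero) w)
                                                                (inner-comb-cong (a ∘ suc) (u ∘ suc) (same ∘ suc)) ⟩
    a zero * inner (u zero) w + inner rest w′      ≡⟨ cong (λ x → a zero * x + inner rest w′) (same zero) ⟩
    a zero * inner (u zero) w′ + inner rest w′     ≡⟨ cong₂ _+_ (inner-⊛ˡ (a zero) (u zero) w′) refl ⟨
    inner (a zero ⊛ u zero) w′ + inner rest w′     ≡⟨ inner-⊕ˡ (a zero ⊛ u zero) rest w′ ⟨
    inner (a zero ⊛ u zero ⊕ rest) w′              ∎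
    where
    open ≡-Reasoning
    rest : EVec n
    rest = comb (a ∘ suc) (u ∘ suc)

  0≤inner : {c w : EVec n} → NonNeg c → NonNeg w → 0ℚ ℚ.≤ inner c w
  0≤inner {c} {w} c≥0 w≥0 = subst (ℚ._≤ inner c w) (inner-zeroˡ w)
    (sumEdges-mono (λ e → ℚP.*-monoʳ-≤-nonNeg (w e) {{ℚ.nonNegative (w≥0 e)}} (c≥0 e)))

  term≤inner : {c w : EVec n} → NonNeg c → NonNeg w → ∀ e₀ → c e₀ * w e₀ ℚ.≤ inner c w
  term≤inner {c} {w} c≥0 w≥0 e₀ = subst (ℚ._≤ inner c w) (inner-unitˡ e₀ (λ e → c e * w e)) (sumEdges-mono unit≤1)
    where
    unit≤1 : ∀ e → unit e₀ e * (c e * w e) ℚ.≤ c e * w e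
    unit≤1 e with ≡-dec-Edge e e₀
    ... | yes _ = ℚP.≤-reflexive (ℚP.*-identityˡ _)
    ... | no _ = subst (ℚ._≤ c e * w e) (sym (ℚP.*-zeroˡ (c e * w e))) (0≤* (c≥0 e) (w≥0 e))

  when : Bool → EVec n → EVec n
  when b u e = if b then u e else 0ℚ

  when-nonNeg : ∀ b {u : EVec n} → NonNeg u → NonNeg (when b u)
  when-nonNeg true u≥0 = u≥0
  when-nonNeg false _ _ = ℚP.≤-refl

  when-≡0 : ∀ b {u : EVec n} {e} → u e ≡ 0ℚ → when b u e ≡ 0ℚ
  when-≡0 true uₑ≡0 = uₑ≡0
  when-≡0 false _ = refl

  inner-whenˡ : ∀ b (u w : EVec n) → inner (when b u) w ≡ (if b then inner u w else 0ℚ)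
  inner-whenˡ true u w = refl
  inner-whenˡ false u w = inner-zeroˡ w

  ⊕-nonNeg : {u w : EVec n} → NonNeg u → NonNeg w → NonNeg (u ⊕ w)
  ⊕-nonNeg u≥0 w≥0 e = ℚP.+-mono-≤ (u≥0 e) (w≥0 e)

  ≤-⊕ˡ : (u : EVec n) {w : EVec n} → NonNeg w → ∀ e → u e ℚ.≤ (u ⊕ w) e
  ≤-⊕ˡ u w≥0 e = x≤x+y (u e) (w≥0 e)

  ≤-⊕ʳ : {u : EVec n} (w : EVec n) → NonNeg u → ∀ e → w e ℚ.≤ (u ⊕ w) e
  ≤-⊕ʳ {u} w u≥0 e = subst (w e ℚ.≤_) (ℚP.+-comm (w e) (u e)) (x≤x+y (w e) (u≥0 e))

-- Gaussian elimination on coordinate zero: subtracting multiples of the pivot row i₀ clears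
-- that coordinate, and a relation among the reduced rows lifts to one among the original rows.
module Pivot {k m : ℕ} (u : Fin (suc k) → Fin (suc m) → ℚ) (i₀ : Fin (suc k)) where

  p : ℚ
  p = u i₀ zero

  row : Fin k → Fin (suc m) → ℚ
  row j = u (punchIn i₀ j)

  reduced : Fin k → Fin (suc m) → ℚ
  reduced j t = p * row j t + - row j zero * u i₀ t

  reduced-zero : ∀ j → reduced j zero ≡ 0ℚ
  reduced-zero j = solve 2 (λ p x → p :* x :+ :- x :* p := con 0ℚ) refl p (row j zero)
    where open +-*-Solver

  lift : (Fin k → ℚ) → Fin (suc k) → ℚ
  lift b = insertAt (λ j → p * b j) i₀ (sum λ j → b j * - row j zero)

  lift-relation : ∀ b t → sum (λ i → lift b i * u i t) ≡ sum (λ j → b j * reduced j t)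
  lift-relation b t = begin
    sum (λ i → lift b i * u i t)
      ≡⟨ sum-remove (λ i → lift b i * u i t) ⟩
    lift b i₀ * u i₀ t + sum (λ j → lift b (punchIn i₀ j) * row j t)
      ≡⟨ cong₂ _+_ (cong (_* u i₀ t) (insertAt-lookup _ i₀ _))
                   (sum-cong-≗ (λ j → cong (_* row j t) (insertAt-punchIn _ i₀ _ j))) ⟩
    S * u i₀ t + sum (λ j → p * b j * row j t)
      ≡⟨ ℚP.+-comm (S * u i₀ t) (sum (λ j → p * b j * row j t)) ⟩
    sum (λ j → p * b j * row j t) + S * u i₀ t
      ≡⟨ cong (sum (λ j → p * b j * row j t) +_) (*-distribʳ-sum (u i₀ t) (λ j → b j * - row j zero)) ⟩
    sum (λ j → p * b j * row j t) + sum (λ j → b j * - row j zero * u i₀ t)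
      ≡⟨ ∑-distrib-+ (λ j → p * b j * row j t) (λ j → b j * - row j zero * u i₀ t) ⟨
    sum (λ j → p * b j * row j t + b j * - row j zero * u i₀ t)
      ≡⟨ sum-cong-≗ (λ j → solve 5 (λ p b y x w → p :* b :* y :+ b :* :- x :* w := b :* (p :* y :+ :- x :* w))
                                    refl p (b j) (row j t) (row j zero) (u i₀ t)) ⟩
    sum (λ j → b j * reduced j t)
      ∎
    where
    open ≡-Reasoning
    open +-*-Solver
    S : ℚ
    S = sum λ j → b j * - row j zero

m<k⇒linearRelation : ∀ m k → m ℕ.< k → (u : Fin k → Fin m → ℚ) →
                     ∃ λ (a : Fin k → ℚ) → (∃ λ i → a i ≢ 0ℚ) × (∀ t → sum (λ i → a i * u i t) ≡ 0ℚ)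
m<k⇒linearRelation zero (suc k) _ u = (λ _ → 1ℚ) , (zero , ℚP.1≢0) , λ ()
m<k⇒linearRelation (suc m) (suc k) (s≤s m<k) u with FinP.any? (λ i → ¬? (u i zero ℚP.≟ 0ℚ))
... | yes (i₀ , p≢0) with m<k⇒linearRelation m k m<k (λ j t → reduced j (suc t))
  where open Pivot u i₀
...   | b , (j , bj≢0) , b-relation = lift b , (punchIn i₀ j , lift≢0) , relation
  where
  open Pivot u i₀
  lift≢0 : lift b (punchIn i₀ j) ≢ 0ℚ
  lift≢0 pbj≡0 = p≢0 (x*y≡0⇒x≡0 p (b j) bj≢0 (trans (sym (insertAt-punchIn _ i₀ _ j)) pbj≡0))
  relation : ∀ t → sum (λ i → lift b i * u i t) ≡ 0ℚ
  relation zero = trans (lift-relation b zero)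
    (sum-zero (λ j → trans (cong (b j *_) (reduced-zero j)) (ℚP.*-zeroʳ (b j))))
  relation (suc t) = trans (lift-relation b (suc t)) (b-relation t)
m<k⇒linearRelation (suc m) (suc k) (s≤s m<k) u | no noPivot with
  m<k⇒linearRelation m (suc k) (ℕP.m<n⇒m<1+n m<k) (λ i t → u i (suc t))
... | a , nontrivial , a-relation = a , nontrivial , relation
  where
  column-zero : ∀ i → u i zero ≡ 0ℚ
  column-zero i = decidable-stable (u i zero ℚP.≟ 0ℚ) (λ ui≢0 → noPivot (i , ui≢0))
  relation : ∀ t → sum (λ i → a i * u i t) ≡ 0ℚ
  relation zero = sum-zero (λ i → trans (cong (a i *_) (column-zero i)) (ℚP.*-zeroʳ (a i)))
  relation (suc t) = a-relation t

triangular⇒LinIndep : ∀ {n k} (u : Fin k → EVec n) (pivot : Fin k → Edge n) (rank : Fin k → ℕ) →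
                      (∀ i → u i (pivot i) ≢ 0ℚ) →
                      (∀ i j → i ≢ j → rank i ≤ rank j → u j (pivot i) ≡ 0ℚ) → LinIndep u
triangular⇒LinIndep {k = k} u pivot rank diagonal upper a relation i = below (suc (rank i)) i ℕP.≤-refl
  where
  below : ∀ r i → rank i ℕ.< r → a i ≡ 0ℚ
  below (suc r) i (s≤s rankᵢ≤r) = x*y≡0⇒x≡0 (a i) (u i (pivot i)) (diagonal i) (begin
    a i * u i (pivot i)                   ≡⟨ sum-single (λ j → a j * u j (pivot i)) i other-terms ⟨
    sum (λ j → a j * u j (pivot i))       ≡⟨ sumFin≡sum k _ ⟨
    sumFin k (λ j → a j * u j (pivot i))  ≡⟨ relation (pivot i) ⟩
    0ℚ                                    ∎)
    where
    open ≡-Reasoning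
    other-terms : ∀ j → j ≢ i → a j * u j (pivot i) ≡ 0ℚ
    other-terms j j≢i with rank j ℕ.<? rank i
    ... | yes rankⱼ<rankᵢ = trans (cong (_* u j (pivot i)) (below r j (ℕP.<-≤-trans rankⱼ<rankᵢ rankᵢ≤r)))
                                  (ℚP.*-zeroˡ (u j (pivot i)))
    ... | no rankⱼ≮rankᵢ = trans (cong (a j *_) (upper i j (j≢i ∘ sym) (ℕP.≮⇒≥ rankⱼ≮rankᵢ))) (ℚP.*-zeroʳ (a j))

record Enumeration {n : ℕ} (m : ℕ) (S : Edge n → Set) : Set where
  field
    edge : Fin m → Edge n
    edge-injective : ∀ {i j} → edge i ≡ edge j → i ≡ j
    edge-∈ : ∀ i → S (edge i)
    edge-onto : ∀ e → S e → ∃ λ i → edge i ≡ e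

edgeCount : ℕ → ℕ
edgeCount zero = zero
edgeCount (suc n) = n ℕ.+ edgeCount n

edgeCount≡nC2 : ∀ n → edgeCount n ≡ n C 2
edgeCount≡nC2 zero = refl
edgeCount≡nC2 (suc n) = trans (cong₂ ℕ._+_ (sym (nC1≡n n)) (edgeCount≡nC2 n)) (nCk+nC[k+1]≡[n+1]C[k+1] n 1)

toEdge : ∀ n → Fin (edgeCount n) → Edge n
toEdge (suc n) x with Fin.splitAt n x
... | inj₁ j = zero , suc j , s≤s z≤n
... | inj₂ y with toEdge n y
... | i , j , i<j = suc i , suc j , s≤s i<j

fromEdge : ∀ n → Edge n → Fin (edgeCount n)
fromEdge (suc n) (zero , suc j , _) = j Fin.↑ˡ edgeCount n
fromEdge (suc n) (suc i , suc j , s≤s i<j) = n Fin.↑ʳ fromEdge n (i , j , i<j)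

fromEdge∘toEdge : ∀ n x → fromEdge n (toEdge n x) ≡ x
fromEdge∘toEdge (suc n) x with Fin.splitAt n x in split
... | inj₁ j = FinP.splitAt⁻¹-↑ˡ split
... | inj₂ y with toEdge n y in toEdge-y
... | i , j , i<j = trans (cong (n Fin.↑ʳ_) (trans (cong (fromEdge n) (sym toEdge-y)) (fromEdge∘toEdge n y)))
                          (FinP.splitAt⁻¹-↑ʳ split)

toEdge∘fromEdge : ∀ n e → toEdge n (fromEdge n e) ≡ e
toEdge∘fromEdge (suc n) (zero , suc j , p) rewrite FinP.splitAt-↑ˡ n j (edgeCount n) = edge-≡ _ p
toEdge∘fromEdge (suc n) (suc i , suc j , s≤s i<j)
  rewrite FinP.splitAt-↑ʳ n (edgeCount n) (fromEdge n (i , j , i<j)) | toEdge∘fromEdge n (i , j , i<j) = refl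

allEdges : ∀ n → Enumeration {n} (n C 2) (λ _ → ⊤)
allEdges n = subst (λ m → Enumeration {n} m (λ _ → ⊤)) (edgeCount≡nC2 n) (record
  { edge = toEdge n
  ; edge-injective = λ {x} {y} eq →
      trans (sym (fromEdge∘toEdge n x)) (trans (cong (fromEdge n) eq) (fromEdge∘toEdge n y))
  ; edge-∈ = λ _ → tt
  ; edge-onto = λ e _ → fromEdge n e , toEdge∘fromEdge n e
  })

module _ {n : ℕ} {S : Edge n → Set} where

  enumeration-∸1< : ∀ {m} → Enumeration m S → ∀ {e₀} → S e₀ → m ℕ.∸ 1 ℕ.< m
  enumeration-∸1< {zero} E e₀∈S with Enumeration.edge-onto E _ e₀∈S
  ... | () , _
  enumeration-∸1< {suc m} _ _ = ℕP.≤-refl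

  remove : ∀ {m} → Enumeration m S → ∀ {e₀} → S e₀ → Enumeration (m ℕ.∸ 1) (λ e → S e × e ≢ e₀)
  remove {zero} E e₀∈S with Enumeration.edge-onto E _ e₀∈S
  ... | () , _
  remove {suc m} E {e₀} e₀∈S = record
    { edge = edge ∘ punchIn i₀
    ; edge-injective = λ eq → FinP.punchIn-injective i₀ _ _ (edge-injective eq)
    ; edge-∈ = λ j → edge-∈ _ , λ eq → FinP.punchInᵢ≢i i₀ j (edge-injective (trans eq (sym edge-i₀)))
    ; edge-onto = onto
    }
    where
    open Enumeration E
    i₀ : Fin (suc m)
    i₀ = proj₁ (edge-onto e₀ e₀∈S)
    edge-i₀ : edge i₀ ≡ e₀
    edge-i₀ = proj₂ (edge-onto e₀ e₀∈S)
    onto : ∀ e → S e × e ≢ e₀ → ∃ λ j → edge (punchIn i₀ j) ≡ e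
    onto e (e∈S , e≢e₀) with edge-onto e e∈S
    ... | i , edge-i = punchOut i₀≢i , trans (cong edge (FinP.punchIn-punchOut i₀≢i)) edge-i
      where
      i₀≢i : i₀ ≢ i
      i₀≢i i₀≡i = e≢e₀ (trans (sym edge-i) (trans (cong edge (sym i₀≡i)) edge-i₀))

Determines : ∀ {n} → (Edge n → Set) → (EVec n → Set) → Set
Determines {n} S K = ∀ {k} (a : Fin k → ℚ) (u : Fin k → EVec n) → (∀ i → K (u i)) →
                     (∀ e → S e → comb a u e ≡ 0ℚ) → ∀ e → comb a u e ≡ 0ℚ

determined⇒¬LinIndep : ∀ {n m k} {S : Edge n → Set} {K : EVec n → Set} → Enumeration m S → Determines S K →
                       m ℕ.< k → (u : Fin k → EVec n) → (∀ i → K (u i)) → ¬ LinIndep u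
determined⇒¬LinIndep {k = k} {S} E determines m<k u u∈K indep
  with m<k⇒linearRelation _ k m<k (λ i t → u i (Enumeration.edge E t))
... | a , (i , aᵢ≢0) , relation = aᵢ≢0 (indep a (determines a u u∈K vanishes-on-S) i)
  where
  vanishes-on-S : ∀ e → S e → comb a u e ≡ 0ℚ
  vanishes-on-S e e∈S with Enumeration.edge-onto E e e∈S
  ... | t , refl = trans (sumFin≡sum k _) (relation t)

lookup-ext : ∀ {n} {xs ys : Vec Bool n} → (∀ i → lookup xs i ≡ lookup ys i) → xs ≡ ys
lookup-ext {xs = xs} {ys} xs≗ys =
  trans (sym (VecP.tabulate∘lookup xs)) (trans (VecP.tabulate-cong xs≗ys) (VecP.tabulate∘lookup ys))

lookup-∁ : ∀ {n} (S : Subset n) i → lookup (∁ S) i ≡ not (lookup S i)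
lookup-∁ S i = VecP.lookup-map i not S

∁-involutive : ∀ {n} (S : Subset n) → ∁ (∁ S) ≡ S
∁-involutive S = trans (sym (VecP.map-∘ not not S)) (trans (VecP.map-cong BoolP.not-involutive S) (VecP.map-id S))

module _ {n : ℕ} where

  cutVec-nonNeg : (S : Subset n) → NonNeg (cutVec S)
  cutVec-nonNeg S (i , j , _) = 0≤indicator (lookup S i xor lookup S j)

  cutVec-∁ : (S : Subset n) → ∀ e → cutVec (∁ S) e ≡ cutVec S e
  cutVec-∁ S (i , j , _) = cong indicator (trans (cong₂ _xor_ (lookup-∁ S i) (lookup-∁ S j))
                                                 (BoolP.xor-annihilates-not (lookup S i) (lookup S j)))

  IsCut-∁ : {S : Subset n} → IsCut S → IsCut (∁ S)
  IsCut-∁ {S} ((i , Sᵢ) , (j , Sⱼ)) =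
    (j , trans (lookup-∁ S j) (cong not Sⱼ)) , (i , trans (lookup-∁ S i) (cong not Sᵢ))

  SameCut-sym : {X Y : Subset n} → SameCut X Y → SameCut Y X
  SameCut-sym (inj₁ X≡Y) = inj₁ (sym X≡Y)
  SameCut-sym {X} {Y} (inj₂ X≡∁Y) = inj₂ (trans (sym (∁-involutive Y)) (cong ∁ (sym X≡∁Y)))

  SameCut-trans : {X Y Z : Subset n} → SameCut X Y → SameCut Y Z → SameCut X Z
  SameCut-trans (inj₁ refl) Y~Z = Y~Z
  SameCut-trans (inj₂ refl) (inj₁ refl) = inj₂ refl
  SameCut-trans {Z = Z} (inj₂ refl) (inj₂ refl) = inj₁ (∁-involutive Z)

  SameCut-∁ : (X : Subset n) → SameCut X (∁ X)
  SameCut-∁ X = inj₂ (sym (∁-involutive X))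

  SameCut? : (X Y : Subset n) → Dec (SameCut X Y)
  SameCut? X Y = VecP.≡-dec Bool._≟_ X Y ⊎-dec VecP.≡-dec Bool._≟_ X (∁ Y)

  InKmin-resp : {X X′ : Subset n} {c : EVec n} → (∀ e → cutVec X e ≡ cutVec X′ e) → InKmin X c → InKmin X′ c
  InKmin-resp {c = c} X≗X′ (c≥0 , minimal) =
    c≥0 , λ Y Y-cut → subst (ℚ._≤ inner c (cutVec Y)) (inner-congʳ c X≗X′) (minimal Y Y-cut)

  InKmin-∁ : (X : Subset n) {c : EVec n} → InKmin X c → InKmin (∁ X) c
  InKmin-∁ X = InKmin-resp {X} {∁ X} (sym ∘ cutVec-∁ X)

  InKmin-∁⁻ : (X : Subset n) {c : EVec n} → InKmin (∁ X) c → InKmin X c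
  InKmin-∁⁻ X = InKmin-resp {∁ X} {X} (cutVec-∁ X)

  InKmin-inner-≡ : {X Y : Subset n} {c : EVec n} → IsCut X → IsCut Y → InKmin X c → InKmin Y c →
                   inner c (cutVec X) ≡ inner c (cutVec Y)
  InKmin-inner-≡ {X = X} {Y} X-cut Y-cut (_ , X-min) (_ , Y-min) = ℚP.≤-antisym (X-min Y Y-cut) (Y-min X X-cut)

  HasDim-resp : {K K′ : EVec n → Set} {k : ℕ} → (∀ c → K c → K′ c) → (∀ c → K′ c → K c) → HasDim K k → HasDim K′ k
  HasDim-resp K⊆K′ K′⊆K ((u , u∈K , indep) , no-larger) =
    (u , (λ i → K⊆K′ _ (u∈K i)) , indep) ,
    λ (u′ , u′∈K′ , indep′) → no-larger (u′ , (λ i → K′⊆K _ (u′∈K′ i)) , indep′)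

  Adjacent-sym : {X Y : Subset n} → Adjacent X Y → Adjacent Y X
  Adjacent-sym {X} {Y} (X≁Y , dim) = X≁Y ∘ SameCut-sym ,
    HasDim-resp {K = λ c → InKmin X c × InKmin Y c} (λ _ (x , y) → y , x) (λ _ (y , x) → x , y) dim

  Adjacent-∁ : {X Y : Subset n} → Adjacent (∁ X) Y → Adjacent X Y
  Adjacent-∁ {X} {Y} (∁X≁Y , dim) =
    (λ X~Y → ∁X≁Y (SameCut-trans (SameCut-sym (SameCut-∁ X)) X~Y)) ,
    HasDim-resp {K = λ c → InKmin (∁ X) c × InKmin Y c}
                (λ _ (x , y) → InKmin-∁⁻ X x , y) (λ _ (x , y) → InKmin-∁ X x , y) dim

  Adjacent-respʳ : {X Y Z : Subset n} → Adjacent X Z → SameCut Z Y → Adjacent X Y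
  Adjacent-respʳ X-Z (inj₁ refl) = X-Z
  Adjacent-respʳ X-Z (inj₂ refl) = Adjacent-sym (Adjacent-∁ (Adjacent-sym X-Z))

module _ {n : ℕ} where

  lookup-⁅⁆-≡ : (v : Fin n) → lookup ⁅ v ⁆ v ≡ true
  lookup-⁅⁆-≡ v = VecP.[]=⇒lookup (x∈⁅x⁆ v)

  lookup-⁅⁆-≢ : {i v : Fin n} → i ≢ v → lookup ⁅ v ⁆ i ≡ false
  lookup-⁅⁆-≢ {i} {v} i≢v = BoolP.¬-not (x≢y⇒x∉⁅y⁆ i≢v ∘ VecP.lookup⇒[]= i ⁅ v ⁆)

  IsCut-⁅⁆ : {v w : Fin n} → w ≢ v → IsCut ⁅ v ⁆
  IsCut-⁅⁆ {v} {w} w≢v = (v , lookup-⁅⁆-≡ v) , (w , lookup-⁅⁆-≢ w≢v)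

  ⁅⁆-distinct : {a b c : Fin n} → a ≢ b → c ≢ a → c ≢ b → ¬ SameCut ⁅ a ⁆ ⁅ b ⁆
  ⁅⁆-distinct {a} {b} {c} a≢b c≢a c≢b (inj₁ ⁅a⁆≡⁅b⁆) = contradiction
    (trans (sym (lookup-⁅⁆-≡ a)) (trans (cong (λ S → lookup S a) ⁅a⁆≡⁅b⁆) (lookup-⁅⁆-≢ a≢b))) λ ()
  ⁅⁆-distinct {a} {b} {c} a≢b c≢a c≢b (inj₂ ⁅a⁆≡∁⁅b⁆) = contradiction
    (trans (sym (lookup-⁅⁆-≢ c≢a)) (trans (cong (λ S → lookup S c) ⁅a⁆≡∁⁅b⁆)
           (trans (lookup-∁ ⁅ b ⁆ c) (cong not (lookup-⁅⁆-≢ c≢b))))) λ ()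

  other-singleton : {X : Subset n} (a b c : Fin n) → a ≢ b → c ≢ a → c ≢ b → SameCut X ⁅ a ⁆ → ¬ SameCut X ⁅ b ⁆
  other-singleton a b c a≢b c≢a c≢b X~a X~b = ⁅⁆-distinct a≢b c≢a c≢b (SameCut-trans (SameCut-sym X~a) X~b)

  edgeBetween : (i j : Fin n) → i ≢ j → Edge n
  edgeBetween i j i≢j with FinP.<-cmp i j
  ... | tri< i<j _ _ = i , j , i<j
  ... | tri≈ _ i≡j _ = contradiction i≡j i≢j
  ... | tri> _ _ j<i = j , i , j<i

  atEdge : {A : Set} → (Fin n → Fin n → A) → Edge n → A
  atEdge F (i , j , _) = F i j

  atEdge-edgeBetween : {A : Set} (F : Fin n → Fin n → A) → (∀ i j → F i j ≡ F j i) →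
                       ∀ i j (i≢j : i ≢ j) → atEdge F (edgeBetween i j i≢j) ≡ F i j
  atEdge-edgeBetween F F-sym i j i≢j with FinP.<-cmp i j
  ... | tri< _ _ _ = refl
  ... | tri≈ _ i≡j _ = contradiction i≡j i≢j
  ... | tri> _ _ _ = F-sym j i

  cutVec-edgeBetween : (S : Subset n) (i j : Fin n) (i≢j : i ≢ j) →
                       cutVec S (edgeBetween i j i≢j) ≡ indicator (lookup S i xor lookup S j)
  cutVec-edgeBetween S = atEdge-edgeBetween (λ i j → indicator (lookup S i xor lookup S j))
                           (λ i j → cong indicator (BoolP.xor-comm (lookup S i) (lookup S j)))

⁅⁆-IsCut : ∀ {k} (v : Fin (suc (suc k))) → IsCut ⁅ v ⁆
⁅⁆-IsCut zero = IsCut-⁅⁆ {v = 0F} {w = 1F} λ ()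
⁅⁆-IsCut (suc v) = IsCut-⁅⁆ {v = suc v} {w = 0F} λ ()

module _ {n : ℕ} where

  pair-determined : (X Y : Subset n) (e₀ : Edge n) → IsCut X → IsCut Y →
                    cutVec X e₀ ≡ 0ℚ → cutVec Y e₀ ≡ 1ℚ → {S : Edge n → Set} →
                    (∀ e → e ≢ e₀ → S e ⊎ (∀ c → InKmin X c → InKmin Y c → c e ≡ 0ℚ)) →
                    Determines S (λ c → InKmin X c × InKmin Y c)
  pair-determined X Y e₀ X-cut Y-cut X-e₀ Y-e₀ covered {k} a u u∈K vanish = everywhere
    where
    z : EVec n
    z = comb a u
    off-e₀ : ∀ e → e ≢ e₀ → z e ≡ 0ℚ
    off-e₀ e e≢e₀ with covered e e≢e₀
    ... | inj₁ e∈S = vanish e e∈S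
    ... | inj₂ forced = trans (sumFin≡sum k _)
      (sum-zero (λ i → trans (cong (a i *_) (forced (u i) (proj₁ (u∈K i)) (proj₂ (u∈K i)))) (ℚP.*-zeroʳ (a i))))
    at-e₀ : z e₀ ≡ 0ℚ
    at-e₀ = begin
      z e₀                    ≡⟨ ℚP.*-identityʳ (z e₀) ⟨
      z e₀ * 1ℚ               ≡⟨ cong (z e₀ *_) Y-e₀ ⟨
      z e₀ * cutVec Y e₀      ≡⟨ inner-supported z (cutVec Y) e₀ off-e₀ ⟨
      inner z (cutVec Y)      ≡⟨ inner-comb-cong a u (λ i → InKmin-inner-≡ {X = X} {Y} X-cut Y-cut
                                                                       (proj₁ (u∈K i)) (proj₂ (u∈K i))) ⟨
      inner z (cutVec X)      ≡⟨ inner-supported z (cutVec X) e₀ off-e₀ ⟩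
      z e₀ * cutVec X e₀      ≡⟨ cong (z e₀ *_) X-e₀ ⟩
      z e₀ * 0ℚ               ≡⟨ ℚP.*-zeroʳ (z e₀) ⟩
      0ℚ                      ∎
      where open ≡-Reasoning
    everywhere : ∀ e → z e ≡ 0ℚ
    everywhere e with ≡-dec-Edge e e₀
    ... | yes refl = at-e₀
    ... | no e≢e₀ = off-e₀ e e≢e₀

-- Every cut is adjacent to every other singleton cut

data Block : Set where
  hub inX outX : Block

data EdgeClass : Set where
  within hubIn hubOut across : EdgeClass

classOf : Block → Block → EdgeClass
-- No edge joins hub to itself; sending that pair to `within` spares side conditions below.
classOf hub hub = within
classOf hub inX = hubIn
classOf hub outX = hubOut
classOf inX hub = hubIn
classOf inX inX = within
classOf inX outX = across
classOf outX hub = hubOut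
classOf outX inX = across
classOf outX outX = within

classOf-comm : ∀ b b′ → classOf b b′ ≡ classOf b′ b
classOf-comm hub hub = refl
classOf-comm hub inX = refl
classOf-comm hub outX = refl
classOf-comm inX hub = refl
classOf-comm inX inX = refl
classOf-comm inX outX = refl
classOf-comm outX hub = refl
classOf-comm outX inX = refl
classOf-comm outX outX = refl

classOf-diagonal : ∀ b → classOf b b ≡ within
classOf-diagonal hub = refl
classOf-diagonal inX = refl
classOf-diagonal outX = refl

classCut : (Block → Bool) → EdgeClass → Bool
classCut y within = false
classCut y hubIn = y hub xor y inX
classCut y hubOut = y hub xor y outX
classCut y across = y inX xor y outX

xor-classCut : ∀ y b b′ → y b xor y b′ ≡ classCut y (classOf b b′)
xor-classCut y hub hub = BoolP.xor-same (y hub)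
xor-classCut y hub inX = refl
xor-classCut y hub outX = refl
xor-classCut y inX hub = BoolP.xor-comm (y inX) (y hub)
xor-classCut y inX inX = BoolP.xor-same (y inX)
xor-classCut y inX outX = refl
xor-classCut y outX hub = BoolP.xor-comm (y outX) (y hub)
xor-classCut y outX inX = BoolP.xor-comm (y outX) (y inX)
xor-classCut y outX outX = BoolP.xor-same (y outX)

addHubIn addAcross addHeavy : EdgeClass → Bool
addHubIn within = false
addHubIn hubIn = false
addHubIn hubOut = true
addHubIn across = true
addAcross within = false
addAcross hubIn = true
addAcross hubOut = true
addAcross across = false
addHeavy within = false
addHeavy _ = true

heavyWeight : EdgeClass → ℚ
heavyWeight within = 1ℚ + 1ℚ
heavyWeight _ = 0ℚ

minValue : EdgeClass → ℚ
minValue within = 0ℚ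
minValue hubIn = 1ℚ
minValue hubOut = 1ℚ + 1ℚ
minValue across = 1ℚ

predicted : (Block → Bool) → EdgeClass → ℚ
predicted y c = indicator (classCut y c) + (if addHubIn c then indicator (classCut y hubIn) else 0ℚ)
                + (if addAcross c then indicator (classCut y across) else 0ℚ)

NonConstant : (Block → Bool) → Set
NonConstant y = ¬ (y hub ≡ y inX × y inX ≡ y outX)

minValue≤predicted : ∀ c y → NonConstant y → minValue c ℚ.≤ predicted y c
minValue≤predicted within y _ = ℚP.≤-refl
minValue≤predicted hubIn y nonConstant with y hub | y inX | y outX
... | true  | true  | true  = contradiction (refl , refl) nonConstant
... | true  | true  | false = ≤-by-eval
... | true  | false | true  = ≤-by-eval
... | true  | false | false = ≤-by-eval
... | false | true  | true  = ≤-by-eval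
... | false | true  | false = ≤-by-eval
... | false | false | true  = ≤-by-eval
... | false | false | false = contradiction (refl , refl) nonConstant
minValue≤predicted hubOut y nonConstant with y hub | y inX | y outX
... | true  | true  | true  = contradiction (refl , refl) nonConstant
... | true  | true  | false = ≤-by-eval
... | true  | false | true  = ≤-by-eval
... | true  | false | false = ≤-by-eval
... | false | true  | true  = ≤-by-eval
... | false | true  | false = ≤-by-eval
... | false | false | true  = ≤-by-eval
... | false | false | false = contradiction (refl , refl) nonConstant
minValue≤predicted across y nonConstant with y hub | y inX | y outX
... | true  | true  | true  = contradiction (refl , refl) nonConstant
... | true  | true  | false = ≤-by-eval
... | true  | false | true  = ≤-by-eval
... | true  | false | false = ≤-by-eval
... | false | true  | true  = ≤-by-eval
... | false | true  | false = ≤-by-eval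
... | false | false | true  = ≤-by-eval
... | false | false | false = contradiction (refl , refl) nonConstant

-- Apart from e and p*, vec e is supported on r* and the within-block edges; ranking these last
-- makes the family triangular.
rankOf : EdgeClass → Bool → ℕ
rankOf within _ = 2
rankOf _ true = 1
rankOf _ false = 0

rankOf≥2 : ∀ c b → 2 ≤ rankOf c b → c ≡ within
rankOf≥2 within _ _ = refl
rankOf≥2 hubIn true (s≤s ())
rankOf≥2 hubOut true (s≤s ())
rankOf≥2 across true (s≤s ())

rankOf≥1 : ∀ c → 1 ≤ rankOf c false → c ≡ within
rankOf≥1 within _ = refl

minValue≤heavy : ∀ c → minValue c ℚ.≤ (if addHeavy c then heavyWeight within else 0ℚ)
minValue≤heavy within = ≤-by-eval
minValue≤heavy hubIn = ≤-by-eval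
minValue≤heavy hubOut = ≤-by-eval
minValue≤heavy across = ≤-by-eval

module SingletonAdjacency {n : ℕ} (X : Subset n) {v x₀ b₀ : Fin n}
  (X-v : lookup X v ≡ true) (X-x₀ : lookup X x₀ ≡ true) (X-b₀ : lookup X b₀ ≡ false) (x₀≢v : x₀ ≢ v) where

  b₀≢v : b₀ ≢ v
  b₀≢v refl = contradiction (trans (sym X-b₀) X-v) λ ()

  x₀≢b₀ : x₀ ≢ b₀
  x₀≢b₀ refl = contradiction (trans (sym X-b₀) X-x₀) λ ()

  block : Fin n → Block
  block i with i FinP.≟ v
  ... | yes _ = hub
  ... | no _ = if lookup X i then inX else outX

  rep : Block → Fin n
  rep hub = v
  rep inX = x₀
  rep outX = b₀

  block-rep : ∀ b → block (rep b) ≡ b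
  block-rep hub with v FinP.≟ v
  ... | yes _ = refl
  ... | no v≢v = contradiction refl v≢v
  block-rep inX with x₀ FinP.≟ v
  ... | yes x₀≡v = contradiction x₀≡v x₀≢v
  ... | no _ rewrite X-x₀ = refl
  block-rep outX with b₀ FinP.≟ v
  ... | yes b₀≡v = contradiction b₀≡v b₀≢v
  ... | no _ rewrite X-b₀ = refl

  class : Edge n → EdgeClass
  class = atEdge (λ i j → classOf (block i) (block j))

  class-edgeBetween : ∀ i j (i≢j : i ≢ j) → class (edgeBetween i j i≢j) ≡ classOf (block i) (block j)
  class-edgeBetween = atEdge-edgeBetween _ (λ i j → classOf-comm (block i) (block j))

  p* r* : Edge n
  p* = edgeBetween v x₀ (x₀≢v ∘ sym)
  r* = edgeBetween x₀ b₀ x₀≢b₀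

  class-p* : class p* ≡ hubIn
  class-p* = trans (class-edgeBetween v x₀ _) (cong₂ classOf (block-rep hub) (block-rep inX))

  class-r* : class r* ≡ across
  class-r* = trans (class-edgeBetween x₀ b₀ _) (cong₂ classOf (block-rep inX) (block-rep outX))

  BlockConstant : Subset n → (Block → Bool) → Set
  BlockConstant Y y = ∀ i → lookup Y i ≡ y (block i)

  cutVec-blockConstant : ∀ {Y y} → BlockConstant Y y → ∀ e → cutVec Y e ≡ indicator (classCut y (class e))
  cutVec-blockConstant {Y} {y} Y≡y (i , j , _) =
    cong indicator (trans (cong₂ _xor_ (Y≡y i) (Y≡y j)) (xor-classCut y (block i) (block j)))

  X-pattern ⁅v⁆-pattern : Block → Bool
  X-pattern hub = true
  X-pattern inX = true
  X-pattern outX = false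
  ⁅v⁆-pattern hub = true
  ⁅v⁆-pattern inX = false
  ⁅v⁆-pattern outX = false

  X-blockConstant : BlockConstant X X-pattern
  X-blockConstant i with i FinP.≟ v
  ... | yes refl = X-v
  ... | no _ with lookup X i
  ...   | true = refl
  ...   | false = refl

  ⁅v⁆-blockConstant : BlockConstant ⁅ v ⁆ ⁅v⁆-pattern
  ⁅v⁆-blockConstant i with i FinP.≟ v
  ... | yes refl = lookup-⁅⁆-≡ v
  ... | no i≢v with lookup X i
  ...   | true = lookup-⁅⁆-≢ i≢v
  ...   | false = lookup-⁅⁆-≢ i≢v

  heavy : EVec n
  heavy e = heavyWeight (class e)

  vec : Edge n → EVec n
  vec e = unit e ⊕ when (addHubIn c) (unit p*) ⊕ when (addAcross c) (unit r*) ⊕ when (addHeavy c) heavy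
    where
    c : EdgeClass
    c = class e

  heavy-nonNeg : NonNeg heavy
  heavy-nonNeg e with class e
  ... | within = ≤-by-eval
  ... | hubIn = ℚP.≤-refl
  ... | hubOut = ℚP.≤-refl
  ... | across = ℚP.≤-refl

  vec-nonNeg : ∀ e → NonNeg (vec e)
  vec-nonNeg e = ⊕-nonNeg (⊕-nonNeg (⊕-nonNeg (unit-nonNeg e) (when-nonNeg (addHubIn (class e)) (unit-nonNeg p*)))
                                     (when-nonNeg (addAcross (class e)) (unit-nonNeg r*)))
                          (when-nonNeg (addHeavy (class e)) heavy-nonNeg)

  inner-heavy-blockConstant : ∀ {Y y} → BlockConstant Y y → inner heavy (cutVec Y) ≡ 0ℚ
  inner-heavy-blockConstant {Y} {y} Y≡y = sumEdges-zero term≡0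
    where
    weight≡0 : ∀ c → heavyWeight c * indicator (classCut y c) ≡ 0ℚ
    weight≡0 within = refl
    weight≡0 hubIn = ℚP.*-zeroˡ (indicator (classCut y hubIn))
    weight≡0 hubOut = ℚP.*-zeroˡ (indicator (classCut y hubOut))
    weight≡0 across = ℚP.*-zeroˡ (indicator (classCut y across))
    term≡0 : ∀ e → heavy e * cutVec Y e ≡ 0ℚ
    term≡0 e = trans (cong (heavy e *_) (cutVec-blockConstant {Y} {y} Y≡y e)) (weight≡0 (class e))

  inner-vec-blockConstant : ∀ {Y y} → BlockConstant Y y → ∀ e → inner (vec e) (cutVec Y) ≡ predicted y (class e)
  inner-vec-blockConstant {Y} {y} Y≡y e = begin
    inner (unit e ⊕ uP ⊕ uR ⊕ uH) w
      ≡⟨ inner-⊕ˡ (unit e ⊕ uP ⊕ uR) uH w ⟩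
    inner (unit e ⊕ uP ⊕ uR) w + inner uH w
      ≡⟨ cong (_+ inner uH w) (trans (inner-⊕ˡ (unit e ⊕ uP) uR w)
                                     (cong (_+ inner uR w) (inner-⊕ˡ (unit e) uP w))) ⟩
    inner (unit e) w + inner uP w + inner uR w + inner uH w
      ≡⟨ cong₂ _+_ (cong₂ _+_ (cong₂ _+_ (inner-unitˡ e w) (inner-whenˡ α (unit p*) w)) (inner-whenˡ β (unit r*) w))
                   (inner-whenˡ γ heavy w) ⟩
    w e + (if α then inner (unit p*) w else 0ℚ) + (if β then inner (unit r*) w else 0ℚ)
        + (if γ then inner heavy w else 0ℚ)
      ≡⟨ cong₂ _+_ (cong₂ _+_ (cong₂ _+_ (cutVec-blockConstant {Y} {y} Y≡y e) (at p* class-p* α)) (at r* class-r* β))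
                   (no-heavy γ) ⟩
    predicted y (class e) + 0ℚ
      ≡⟨ ℚP.+-identityʳ (predicted y (class e)) ⟩
    predicted y (class e)
      ∎
    where
    open ≡-Reasoning
    w : EVec n
    w = cutVec Y
    α β γ : Bool
    α = addHubIn (class e)
    β = addAcross (class e)
    γ = addHeavy (class e)
    uP uR uH : EVec n
    uP = when α (unit p*)
    uR = when β (unit r*)
    uH = when γ heavy
    at : ∀ e′ {c} → class e′ ≡ c → ∀ b →
         (if b then inner (unit e′) w else 0ℚ) ≡ (if b then indicator (classCut y c) else 0ℚ)
    at e′ refl true = trans (inner-unitˡ e′ w) (cutVec-blockConstant {Y} {y} Y≡y e′)
    at e′ refl false = refl
    no-heavy : ∀ b → (if b then inner heavy w else 0ℚ) ≡ 0ℚ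
    no-heavy true = inner-heavy-blockConstant {Y} {y} Y≡y
    no-heavy false = refl

  predicted-X : ∀ c → predicted X-pattern c ≡ minValue c
  predicted-X within = refl
  predicted-X hubIn = refl
  predicted-X hubOut = refl
  predicted-X across = refl

  predicted-⁅v⁆ : ∀ c → predicted ⁅v⁆-pattern c ≡ minValue c
  predicted-⁅v⁆ within = refl
  predicted-⁅v⁆ hubIn = refl
  predicted-⁅v⁆ hubOut = refl
  predicted-⁅v⁆ across = refl

  blockConstant⇒NonConstant : ∀ {Y y} → IsCut Y → BlockConstant Y y → NonConstant y
  blockConstant⇒NonConstant {Y} {y} ((i , Yᵢ) , (j , Yⱼ)) Y≡y (h≡i , i≡o) =
    contradiction (trans (sym Yᵢ) (trans (Y≡y i) (trans (y≡yhub (block i))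
                  (trans (sym (y≡yhub (block j))) (trans (sym (Y≡y j)) Yⱼ))))) λ ()
    where
    y≡yhub : ∀ b → y b ≡ y hub
    y≡yhub hub = refl
    y≡yhub inX = sym h≡i
    y≡yhub outX = sym (trans h≡i i≡o)

  within-edge : ∀ {Y} i → lookup Y i ≢ lookup Y (rep (block i)) →
                ∃ λ e → class e ≡ within × cutVec Y e ≡ 1ℚ
  within-edge {Y} i Yᵢ≢ = edgeBetween i j i≢j ,
    trans (class-edgeBetween i j i≢j) (trans (cong (classOf (block i)) (block-rep (block i))) (classOf-diagonal (block i))) ,
    trans (cutVec-edgeBetween Y i j i≢j)
          (cong indicator (trans (cong (_xor lookup Y j) (BoolP.¬-not Yᵢ≢)) (BoolP.xor-inverseˡ (lookup Y j))))
    where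
    j : Fin n
    j = rep (block i)
    i≢j : i ≢ j
    i≢j = Yᵢ≢ ∘ cong (lookup Y)

  heavy≤vec : ∀ e e′ → class e′ ≡ within → (if addHeavy (class e) then heavyWeight within else 0ℚ) ℚ.≤ vec e e′
  heavy≤vec e e′ class-e′ = subst (ℚ._≤ vec e e′) (cong (λ c → if addHeavy (class e) then heavyWeight c else 0ℚ) class-e′)
    (≤-⊕ʳ (when (addHeavy (class e)) heavy)
          (⊕-nonNeg (⊕-nonNeg (unit-nonNeg e) (when-nonNeg (addHubIn (class e)) (unit-nonNeg p*)))
                    (when-nonNeg (addAcross (class e)) (unit-nonNeg r*))) e′)

  -- A cut that is not a union of blocks cuts a within-block edge, which alone weighs enough.
  minValue≤inner-vec : ∀ e (Y : Subset n) → IsCut Y → minValue (class e) ℚ.≤ inner (vec e) (cutVec Y)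
  minValue≤inner-vec e Y Y-cut with FinP.all? (λ i → lookup Y i Bool.≟ lookup Y (rep (block i)))
  ... | yes Y≡y = subst (minValue (class e) ℚ.≤_) (sym (inner-vec-blockConstant {Y} {y} Y≡y e))
                        (minValue≤predicted (class e) y (blockConstant⇒NonConstant {Y} {y} Y-cut Y≡y))
    where
    y : Block → Bool
    y = lookup Y ∘ rep
  ... | no ¬Y≡y with FinP.¬∀⟶∃¬ n _ (λ i → lookup Y i Bool.≟ lookup Y (rep (block i))) ¬Y≡y
  ...   | i , Yᵢ≢ with within-edge {Y} i Yᵢ≢
  ...     | e′ , class-e′ , Yₑ′ = begin
    minValue (class e)                                       ≤⟨ minValue≤heavy (class e) ⟩
    (if addHeavy (class e) then heavyWeight within else 0ℚ)  ≤⟨ heavy≤vec e e′ class-e′ ⟩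
    vec e e′                                                 ≡⟨ ℚP.*-identityʳ (vec e e′) ⟨
    vec e e′ * 1ℚ                                            ≡⟨ cong (vec e e′ *_) Yₑ′ ⟨
    vec e e′ * cutVec Y e′                                   ≤⟨ term≤inner (vec-nonNeg e) (cutVec-nonNeg Y) e′ ⟩
    inner (vec e) (cutVec Y)                                 ∎
    where open ℚP.≤-Reasoning

  vec∈X-cone : ∀ e → InKmin X (vec e)
  vec∈X-cone e = vec-nonNeg e , λ Y Y-cut →
    subst (ℚ._≤ inner (vec e) (cutVec Y))
          (sym (trans (inner-vec-blockConstant {X} {X-pattern} X-blockConstant e) (predicted-X (class e))))
          (minValue≤inner-vec e Y Y-cut)

  vec∈⁅v⁆-cone : ∀ e → InKmin ⁅ v ⁆ (vec e)
  vec∈⁅v⁆-cone e = vec-nonNeg e , λ Y Y-cut →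
    subst (ℚ._≤ inner (vec e) (cutVec Y))
          (sym (trans (inner-vec-blockConstant {⁅ v ⁆} {⁅v⁆-pattern} ⁅v⁆-blockConstant e) (predicted-⁅v⁆ (class e))))
          (minValue≤inner-vec e Y Y-cut)

  rank : Edge n → ℕ
  rank e = rankOf (class e) (does (≡-dec-Edge e r*))

  rank-r* : rank r* ≡ 1
  rank-r* = cong₂ rankOf class-r* (dec-true (≡-dec-Edge r* r*) refl)

  rank-≢r* : ∀ {e} → e ≢ r* → rank e ≡ rankOf (class e) false
  rank-≢r* {e} e≢r* = cong (rankOf (class e)) (dec-false (≡-dec-Edge e r*) e≢r*)

  heavy-support : ∀ e → class e ≡ within ⊎ heavy e ≡ 0ℚ
  heavy-support e with class e
  ... | within = inj₁ refl
  ... | hubIn = inj₂ refl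
  ... | hubOut = inj₂ refl
  ... | across = inj₂ refl

  vec-diagonal : ∀ e → vec e e ≢ 0ℚ
  vec-diagonal e = 1≤x⇒x≢0 (begin
    1ℚ                               ≡⟨ unit-≡ e ⟨
    unit e e                         ≤⟨ ≤-⊕ˡ (unit e) (when-nonNeg α (unit-nonNeg p*)) e ⟩
    (unit e ⊕ uP) e                  ≤⟨ ≤-⊕ˡ (unit e ⊕ uP) (when-nonNeg β (unit-nonNeg r*)) e ⟩
    (unit e ⊕ uP ⊕ uR) e             ≤⟨ ≤-⊕ˡ (unit e ⊕ uP ⊕ uR) (when-nonNeg γ heavy-nonNeg) e ⟩
    vec e e                          ∎)
    where
    open ℚP.≤-Reasoning
    α β γ : Bool
    α = addHubIn (class e)
    β = addAcross (class e)
    γ = addHeavy (class e)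
    uP uR : EVec n
    uP = when α (unit p*)
    uR = when β (unit r*)

  vec-offDiagonal : ∀ e e′ → e ≢ e′ → e′ ≢ p* → rank e′ ≤ rank e → vec e e′ ≡ 0ℚ
  vec-offDiagonal e e′ e≢e′ e′≢p* rank≤ =
    cong₂ _+_ (cong₂ _+_ (cong₂ _+_ (unit-≢ (e≢e′ ∘ sym)) (when-≡0 (addHubIn (class e)) {unit p*} {e′} (unit-≢ e′≢p*)))
                         (r*-term (≡-dec-Edge e′ r*)))
              heavy-term
    where
    r*-term : Dec (e′ ≡ r*) → when (addAcross (class e)) (unit r*) e′ ≡ 0ℚ
    r*-term (no e′≢r*) = when-≡0 (addAcross (class e)) {unit r*} {e′} (unit-≢ e′≢r*)
    r*-term (yes refl) = cong (λ c → when (addAcross c) (unit r*) r*) e-within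
      where
      e-within : class e ≡ within
      e-within = rankOf≥1 (class e) (subst₂ _≤_ rank-r* (rank-≢r* e≢e′) rank≤)
    heavy-term : when (addHeavy (class e)) heavy e′ ≡ 0ℚ
    heavy-term with heavy-support e′
    ... | inj₂ heavy≡0 = when-≡0 (addHeavy (class e)) {heavy} {e′} heavy≡0
    ... | inj₁ e′-within = cong (λ c → when (addHeavy c) heavy e′) e-within
      where
      e-within : class e ≡ within
      e-within = rankOf≥2 (class e) _ (subst (_≤ rank e) (cong₂ rankOf e′-within refl) rank≤)

  others : Enumeration (n C 2 ℕ.∸ 1) (λ e → ⊤ × e ≢ p*)
  others = remove (allEdges n) tt

  open Enumeration others using (edge; edge-injective; edge-∈)

  family : Fin (n C 2 ℕ.∸ 1) → EVec n
  family = vec ∘ edge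

  family-LinIndep : LinIndep family
  family-LinIndep = triangular⇒LinIndep family edge (rank ∘ edge) (vec-diagonal ∘ edge)
    (λ i j i≢j rank≤ → vec-offDiagonal (edge j) (edge i) (i≢j ∘ sym ∘ edge-injective) (proj₂ (edge-∈ i)) rank≤)

  X-cut : IsCut X
  X-cut = (v , X-v) , (b₀ , X-b₀)

  cutVec-X-p* : cutVec X p* ≡ 0ℚ
  cutVec-X-p* = trans (cutVec-edgeBetween X v x₀ _) (cong indicator (cong₂ _xor_ X-v X-x₀))

  cutVec-⁅v⁆-p* : cutVec ⁅ v ⁆ p* ≡ 1ℚ
  cutVec-⁅v⁆-p* = trans (cutVec-edgeBetween ⁅ v ⁆ v x₀ _)
                        (cong indicator (cong₂ _xor_ (lookup-⁅⁆-≡ v) (lookup-⁅⁆-≢ x₀≢v)))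

  adjacent : ¬ SameCut X ⁅ v ⁆ → Adjacent X ⁅ v ⁆
  adjacent X≁⁅v⁆ = X≁⁅v⁆ , (family , (λ j → vec∈X-cone (edge j) , vec∈⁅v⁆-cone (edge j)) , family-LinIndep) ,
    λ (u , u∈K , indep) → determined⇒¬LinIndep {K = λ c → InKmin X c × InKmin ⁅ v ⁆ c} others
      (pair-determined X ⁅ v ⁆ p* X-cut (IsCut-⁅⁆ b₀≢v) cutVec-X-p* cutVec-⁅v⁆-p* (λ e e≢p* → inj₁ (tt , e≢p*)))
      ℕP.≤-refl u u∈K indep

module _ {n : ℕ} where

  adjacent-⁅⁆-∈ : (X : Subset n) (v : Fin n) → IsCut X → lookup X v ≡ true → ¬ SameCut X ⁅ v ⁆ → Adjacent X ⁅ v ⁆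
  adjacent-⁅⁆-∈ X v (_ , (b₀ , X-b₀)) X-v X≁⁅v⁆ with FinP.any? (λ i → (lookup X i Bool.≟ true) ×-dec ¬? (i FinP.≟ v))
  ... | yes (x₀ , X-x₀ , x₀≢v) = SingletonAdjacency.adjacent X X-v X-x₀ X-b₀ x₀≢v X≁⁅v⁆
  ... | no no-other = contradiction (inj₁ (lookup-ext X≗⁅v⁆)) X≁⁅v⁆
    where
    X≗⁅v⁆ : ∀ i → lookup X i ≡ lookup ⁅ v ⁆ i
    X≗⁅v⁆ i with i FinP.≟ v
    ... | yes refl = trans X-v (sym (lookup-⁅⁆-≡ v))
    ... | no i≢v = trans (BoolP.¬-not (λ Xᵢ → no-other (i , Xᵢ , i≢v))) (sym (lookup-⁅⁆-≢ i≢v))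

  adjacent-⁅⁆ : (X : Subset n) (v : Fin n) → IsCut X → ¬ SameCut X ⁅ v ⁆ → Adjacent X ⁅ v ⁆
  adjacent-⁅⁆ X v X-cut X≁⁅v⁆ with lookup X v in X-v
  ... | true = adjacent-⁅⁆-∈ X v X-cut X-v X≁⁅v⁆
  ... | false = Adjacent-∁ (adjacent-⁅⁆-∈ (∁ X) v (IsCut-∁ {S = X} X-cut) (trans (lookup-∁ X v) (cong not X-v))
                                          (X≁⁅v⁆ ∘ SameCut-trans (SameCut-∁ X)))

module _ {m : ℕ} where

  avoiding-singleton : (X Y : Subset (3 ℕ.+ m)) → ∃ λ v → ¬ SameCut X ⁅ v ⁆ × ¬ SameCut Y ⁅ v ⁆
  avoiding-singleton X Y with SameCut? X ⁅ 0F ⁆ | SameCut? Y ⁅ 0F ⁆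
  ... | no X≁0 | no Y≁0 = 0F , X≁0 , Y≁0
  ... | yes X~0 | _ with SameCut? Y ⁅ 1F ⁆
  ...   | no Y≁1 = 1F , other-singleton 0F 1F 2F (λ ()) (λ ()) (λ ()) X~0 , Y≁1
  ...   | yes Y~1 = 2F , other-singleton 0F 2F 1F (λ ()) (λ ()) (λ ()) X~0
                         , other-singleton 1F 2F 0F (λ ()) (λ ()) (λ ()) Y~1
  avoiding-singleton X Y | no _ | yes Y~0 with SameCut? X ⁅ 1F ⁆
  ... | no X≁1 = 1F , X≁1 , other-singleton 0F 1F 2F (λ ()) (λ ()) (λ ()) Y~0
  ... | yes X~1 = 2F , other-singleton 1F 2F 0F (λ ()) (λ ()) (λ ()) X~1
                     , other-singleton 0F 2F 1F (λ ()) (λ ()) (λ ()) Y~0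

  distance≤2 : (X Y : Subset (3 ℕ.+ m)) → IsCut X → IsCut Y → DistLe 2 X Y
  distance≤2 X Y X-cut Y-cut with avoiding-singleton X Y
  ... | v , X≁⁅v⁆ , Y≁⁅v⁆ =
    2 , ℕP.≤-refl , ⁅ v ⁆ , ⁅⁆-IsCut v , adjacent-⁅⁆ X v X-cut X≁⁅v⁆ ,
    Y , Y-cut , Adjacent-sym (adjacent-⁅⁆ Y v Y-cut Y≁⁅v⁆) , inj₁ refl

-- Submodularity of the cut function

crossing : Bool → Bool → Bool → Bool → Bool
crossing a b c d = (a ∧ not c ∧ d ∧ not b) ∨ (c ∧ not a ∧ b ∧ not d)

submodular-bits : ∀ a b c d → indicator (a xor b) + indicator (c xor d) ≡
                  indicator ((a ∧ c) xor (b ∧ d)) + indicator ((a ∨ c) xor (b ∨ d))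
                  + (indicator (crossing a b c d) + indicator (crossing a b c d))
submodular-bits true true true true = refl
submodular-bits true true true false = refl
submodular-bits true true false true = refl
submodular-bits true true false false = refl
submodular-bits true false true true = refl
submodular-bits true false true false = refl
submodular-bits true false false true = refl
submodular-bits true false false false = refl
submodular-bits false true true true = refl
submodular-bits false true true false = refl
submodular-bits false true false true = refl
submodular-bits false true false false = refl
submodular-bits false false true true = refl
submodular-bits false false true false = refl
submodular-bits false false false true = refl
submodular-bits false false false false = refl

module _ {n : ℕ} (X Y : Subset n) where

  crosses : EVec n
  crosses = atEdge λ i j → indicator (crossing (lookup X i) (lookup X j) (lookup Y i) (lookup Y j))

  cutVec-submodular : ∀ e → (cutVec X ⊕ cutVec Y) e ≡ (cutVec (X ∩ Y) ⊕ cutVec (X ∪ Y) ⊕ (crosses ⊕ crosses)) e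
  cutVec-submodular (i , j , _)
    rewrite VecP.lookup-zipWith _∧_ i X Y | VecP.lookup-zipWith _∧_ j X Y
          | VecP.lookup-zipWith _∨_ i X Y | VecP.lookup-zipWith _∨_ j X Y
    = submodular-bits (lookup X i) (lookup X j) (lookup Y i) (lookup Y j)

  inner-submodular : ∀ c → inner c (cutVec X) + inner c (cutVec Y) ≡
                     inner c (cutVec (X ∩ Y)) + inner c (cutVec (X ∪ Y)) + (inner c crosses + inner c crosses)
  inner-submodular c = begin
    inner c (cutVec X) + inner c (cutVec Y)
      ≡⟨ inner-⊕ʳ c (cutVec X) (cutVec Y) ⟨
    inner c (cutVec X ⊕ cutVec Y)
      ≡⟨ inner-congʳ c cutVec-submodular ⟩
    inner c (cutVec (X ∩ Y) ⊕ cutVec (X ∪ Y) ⊕ (crosses ⊕ crosses))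
      ≡⟨ trans (inner-⊕ʳ c (cutVec (X ∩ Y) ⊕ cutVec (X ∪ Y)) (crosses ⊕ crosses))
               (cong₂ _+_ (inner-⊕ʳ c (cutVec (X ∩ Y)) (cutVec (X ∪ Y))) (inner-⊕ʳ c crosses crosses)) ⟩
    inner c (cutVec (X ∩ Y)) + inner c (cutVec (X ∪ Y)) + (inner c crosses + inner c crosses)
      ∎
    where open ≡-Reasoning

  crosses-nonNeg : NonNeg crosses
  crosses-nonNeg (i , j , _) = 0≤indicator (crossing (lookup X i) (lookup X j) (lookup Y i) (lookup Y j))

  InKmin-uncrossed : IsCut (X ∩ Y) → IsCut (X ∪ Y) → ∀ {c} → InKmin X c → InKmin Y c →
                     ∀ e → crosses e ≡ 1ℚ → c e ≡ 0ℚ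
  InKmin-uncrossed X∩Y-cut X∪Y-cut {c} (c≥0 , X-min) (_ , Y-min) e crosses-e = ℚP.≤-antisym cₑ≤0 (c≥0 e)
    where
    κ : ℚ
    κ = inner c crosses
    2κ≤0 : κ + κ ℚ.≤ 0ℚ
    2κ≤0 = x+y≤x⇒y≤0 (inner c (cutVec X) + inner c (cutVec Y)) (κ + κ) (begin
      inner c (cutVec X) + inner c (cutVec Y) + (κ + κ)
        ≤⟨ ℚP.+-monoˡ-≤ (κ + κ) (ℚP.+-mono-≤ (X-min (X ∩ Y) X∩Y-cut) (Y-min (X ∪ Y) X∪Y-cut)) ⟩
      inner c (cutVec (X ∩ Y)) + inner c (cutVec (X ∪ Y)) + (κ + κ)
        ≡⟨ inner-submodular c ⟨
      inner c (cutVec X) + inner c (cutVec Y)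
        ∎)
      where open ℚP.≤-Reasoning
    cₑ≤0 : c e ℚ.≤ 0ℚ
    cₑ≤0 = begin
      c e                ≡⟨ ℚP.*-identityʳ (c e) ⟨
      c e * 1ℚ           ≡⟨ cong (c e *_) crosses-e ⟨
      c e * crosses e    ≤⟨ term≤inner c≥0 crosses-nonNeg e ⟩
      κ                  ≤⟨ x≤x+y κ (0≤inner c≥0 crosses-nonNeg) ⟩
      κ + κ              ≤⟨ 2κ≤0 ⟩
      0ℚ                 ∎
      where open ℚP.≤-Reasoning

module FarPair (m : ℕ) where

  X₀ Y₀ : Subset (4 ℕ.+ m)
  X₀ = true ∷ true ∷ false ∷ false ∷ Vec.replicate m false
  Y₀ = true ∷ false ∷ true ∷ false ∷ Vec.replicate m false

  X₀-cut : IsCut X₀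
  X₀-cut = (0F , refl) , (2F , refl)

  Y₀-cut : IsCut Y₀
  Y₀-cut = (0F , refl) , (1F , refl)

  X₀≁Y₀ : ¬ SameCut X₀ Y₀
  X₀≁Y₀ (inj₁ X₀≡Y₀) = contradiction (cong (λ S → lookup S 1F) X₀≡Y₀) λ ()
  X₀≁Y₀ (inj₂ X₀≡∁Y₀) = contradiction (cong (λ S → lookup S 0F) X₀≡∁Y₀) λ ()

  e₁₂ e₀₂ : Edge (4 ℕ.+ m)
  e₁₂ = 1F , 2F , s≤s (s≤s z≤n)
  e₀₂ = 0F , 2F , s≤s z≤n

  cone-e₁₂ : ∀ c → InKmin Y₀ c → InKmin X₀ c → c e₁₂ ≡ 0ℚ
  cone-e₁₂ c Y₀-min X₀-min =
    InKmin-uncrossed X₀ Y₀ ((0F , refl) , (1F , refl)) ((0F , refl) , (3F , refl)) X₀-min Y₀-min e₁₂ refl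

  ¬Adjacent : ¬ Adjacent X₀ Y₀
  ¬Adjacent (_ , (u , u∈K , indep) , _) =
    determined⇒¬LinIndep {K = λ c → InKmin Y₀ c × InKmin X₀ c} without-e₀₂
      (pair-determined Y₀ X₀ e₀₂ Y₀-cut X₀-cut refl refl covered)
      (enumeration-∸1< without-e₁₂ (tt , e₀₂≢e₁₂)) u (swap ∘ u∈K) indep
    where
    e₀₂≢e₁₂ : e₀₂ ≢ e₁₂
    e₀₂≢e₁₂ ()
    without-e₁₂ : Enumeration ((4 ℕ.+ m) C 2 ℕ.∸ 1) (λ e → ⊤ × e ≢ e₁₂)
    without-e₁₂ = remove (allEdges (4 ℕ.+ m)) tt
    without-e₀₂ : Enumeration ((4 ℕ.+ m) C 2 ℕ.∸ 1 ℕ.∸ 1) (λ e → (⊤ × e ≢ e₁₂) × e ≢ e₀₂)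
    without-e₀₂ = remove without-e₁₂ (tt , e₀₂≢e₁₂)
    covered : ∀ e → e ≢ e₀₂ → ((⊤ × e ≢ e₁₂) × e ≢ e₀₂) ⊎ (∀ c → InKmin Y₀ c → InKmin X₀ c → c e ≡ 0ℚ)
    covered e e≢e₀₂ with ≡-dec-Edge e e₁₂
    ... | yes refl = inj₂ cone-e₁₂
    ... | no e≢e₁₂ = inj₁ ((tt , e≢e₁₂) , e≢e₀₂)

  distance>1 : ¬ DistLe 1 X₀ Y₀
  distance>1 (0 , _ , X₀~Y₀) = X₀≁Y₀ X₀~Y₀
  distance>1 (1 , _ , Z , _ , X₀-Z , Z~Y₀) = ¬Adjacent (Adjacent-respʳ X₀-Z Z~Y₀)
  distance>1 (suc (suc _) , s≤s () , _)

theorem4 : (n : ℕ) → 4 ≤ n → HasDiameter n 2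
theorem4 _ (s≤s (s≤s (s≤s (s≤s {n = m} _)))) = distance≤2 , X₀ , Y₀ , X₀-cut , Y₀-cut , distance>1
  where open FarPair m
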